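{- Let $k\geq 2$ and $r\geq 1$ be integers and let $A_{k,r}$ be the Andrásfai graph. Then: (a) $A_{k,r}$ is $r$-regular; (b) $A_{k,r}$ contains no odd cycle of length at most $2k-1$; (c) if $r\geq 2$, then any two vertices of $A_{k,r}$ are contained in a cycle of length $2k+1$; (d) if there is a graph homomorphism from $A_{k,r}$ to a graph $H$ with $|V(H)|<|V(A_{k,r})|$, then $H$ contains an odd cycle of length at most $2k-1$. In particular, $\delta_{\mathrm{hom}}(\mathscr{C}_{2k-1})\geq\frac{1}{2k-1}$, where $\mathscr{C}_{2k-1}=\{C_3,C_5,\dots,C_{2k-1}\}$.
   Context: Let $n=(2k-1)(r-1)+2$. The Andrásfai graph $A_{k,r}$ is the graph with vertex set $\{i/n\colon i=0,\dots,n-1\}\subseteq\mathbb{R}/\mathbb{Z}$, where two vertices $u,v$ are adjacent iff $v-u\in\big(\tfrac{k-1}{2k-1},\tfrac{k}{2k-1}\big)$ modulo $1$ (equivalently, their distance on the circle $\mathbb{R}/\mathbb{Z}$ exceeds $\tfrac{k-1}{2k-1}$). All graphs are finite and simple. For a family $\mathscr{F}$ of graphs, $\mathscr{G}_{\mathscr{F}}(\alpha)$ is the class of $\mathscr{F}$-free graphs $G$ (no subgraph isomorphic to a member of $\mathscr{F}$) with $\delta(G)\geq\alpha|V(G)|$, and $\delta_{\mathrm{hom}}(\mathscr{F})=\inf\{\alpha\in[0,1]\colon$ there is a finite $\mathscr{F}$-free graph $H$ such that every $G\in\mathscr{G}_{\mathscr{F}}(\alpha)$ admits a homomorphism to $H\}$.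 -}

module Defs where

open import Data.Bool using (Bool; true; false; _∧_; if_then_else_)
open import Data.Nat using (ℕ; zero; suc; _+_; _*_; _∸_; _≤_; _<_; _<?_; _%_)
open import Data.Fin using (Fin; toℕ)
open import Data.List using (List; map; allFin)
open import Data.Nat.ListAction using (sum)
open import Data.Product using (Σ; ∃; _×_; _,_)
open import Data.Sum using (_⊎_)
open import Relation.Nullary using (¬_)
open import Relation.Nullary.Decidable using (⌊_⌋)
open import Relation.Binary.PropositionalEquality using (_≡_)
open import Function.Definitions using (Injective)

record Graph : Set where
  constructor mkGraph
  field
    order : ℕ
    adj   : Fin order → Fin order → Bool

open Graph public

V : Graph → Set
V G = Fin (order G)

_~[_]_ : {G : Graph} → V G → Graph → V G → Set
_~[_]_ {G} u _ v = adj G u v ≡ true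

record IsSimple (G : Graph) : Set where
  field
    symmetric  : ∀ u v → adj G u v ≡ adj G v u
    irreflexive : ∀ u → adj G u u ≡ false

degree : (G : Graph) → V G → ℕ
degree G v = sum (map (λ w → if adj G v w then 1 else 0) (allFin (order G)))

IsRegular : Graph → ℕ → Set
IsRegular G r = ∀ v → degree G v ≡ r

record Cycle (G : Graph) (ℓ : ℕ) : Set where
  field
    len≥3 : 3 ≤ ℓ
    vtx   : Fin ℓ → V G
    inj   : Injective _≡_ _≡_ vtx
    edge  : ∀ (i j : Fin ℓ) →
            (suc (toℕ i) ≡ toℕ j ⊎ (suc (toℕ i) ≡ ℓ × toℕ j ≡ 0)) →
            adj G (vtx i) (vtx j) ≡ true

HasShortOddCycle : Graph → ℕ → Set
HasShortOddCycle G k = Σ ℕ λ j → (2 * j + 3 ≤ 2 * k ∸ 1) × Cycle G (2 * j + 3)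

OddCycleFree : Graph → ℕ → Set
OddCycleFree G k = ¬ HasShortOddCycle G k

Hom : Graph → Graph → Set
Hom G H = Σ (V G → V H) λ φ → ∀ u v → adj G u v ≡ true → adj H (φ u) (φ v) ≡ true

-- Andrásfai graph A_{k,r}: n = (2k-1)(r-1)+2 vertices i/n on R/Z,
-- u ~ v iff (v-u) mod 1 ∈ ((k-1)/(2k-1), k/(2k-1)).
-- With d = (v - u) mod n this is (k-1)·n < d·(2k-1) < k·n.
andrasfaiOrder : ℕ → ℕ → ℕ
andrasfaiOrder k r = 2 + (2 * k ∸ 1) * (r ∸ 1)

andrasfaiAdj : (k r : ℕ) → Fin (andrasfaiOrder k r) → Fin (andrasfaiOrder k r) → Bool
andrasfaiAdj k r u v =
  ⌊ (k ∸ 1) * n <? d * (2 * k ∸ 1) ⌋ ∧ ⌊ d * (2 * k ∸ 1) <? k * n ⌋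
  where
    n = andrasfaiOrder k r
    d = (toℕ v + andrasfaiOrder k r ∸ toℕ u) % andrasfaiOrder k r

Andrasfai : ℕ → ℕ → Graph
Andrasfai k r = mkGraph (andrasfaiOrder k r) (andrasfaiAdj k r)

-- Minimum degree condition δ(G) ≥ α|V(G)| for a rational α = p/q (q > 0):
-- q · deg(v) ≥ p · |V(G)| for every vertex v.
MinDegAtLeast : Graph → ℕ → ℕ → Set
MinDegAtLeast G p q = ∀ v → p * order G ≤ q * degree G v

-- α = p/q belongs to the set in the definition of δ_hom(𝒞_{2k-1}):
-- there is a finite 𝒞_{2k-1}-free H such that every 𝒞_{2k-1}-free G with
-- δ(G) ≥ α|V(G)| admits a homomorphism to H.
HomThresholdWitness : ℕ → ℕ → ℕ → Set
HomThresholdWitness k p q =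
  Σ Graph λ H → IsSimple H × OddCycleFree H k ×
    (∀ (G : Graph) → IsSimple G → OddCycleFree G k → MinDegAtLeast G p q → Hom G H)

-- δ_hom(𝒞_{2k-1}) ≥ 1/(2k-1): no α = p/q < 1/(2k-1) lies in the set.
-- (The set is upward closed in α, so its infimum is ≥ c iff no rational α < c lies in it.)
DeltaHomAtLeastInv : ℕ → Set
DeltaHomAtLeastInv k =
  ∀ (p q : ℕ) → 0 < q → p * (2 * k ∸ 1) < q → ¬ HomThresholdWitness k p q

module Submission where

-- A_{k,r} is the circulant graph on ℤ/n whose connection set is the interval [a, b] with
-- a = (k-1)(r-1)+1, b = k(r-1)+1 and a + b = n, so it is simple and (b-a+1)-regular.
-- The offsets along a closed walk of length L add up to a multiple qn of n with
-- La ≤ qn ≤ Lb, and for odd L ≤ 2k-1 no multiple of n lies in that range.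
-- For r ≥ 2 a zigzag of 2k+1 steps joins any two vertices into a cycle. A homomorphism
-- into a smaller graph identifies two vertices of such a cycle; splitting the image walk at
-- the repeated vertex leaves an odd closed walk of length at most 2k-1, and a shortest odd
-- closed walk is an odd cycle. Taking r = |V(H)| + 1 then gives a C_{2k-1}-free graph with
-- minimum degree at least n/(2k-1) that has no homomorphism to H.

open import Defs
open import Data.Bool using (Bool; true; false; _∧_; if_then_else_)
open import Data.Bool.Properties using (T-≡; T-∧; ¬-not; ⇔→≡)
open import Data.Empty using (⊥; ⊥-elim)
open import Data.Fin as Fin using (Fin; toℕ; fromℕ<)
open import Data.Fin.Properties using (toℕ-injective; toℕ-fromℕ<; toℕ<n; any?; pigeonhole)
open import Data.List using (tabulate)
open import Data.List.Properties using (map-tabulate)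
open import Data.Nat
open import Data.Nat.DivMod
open import Data.Nat.Divisibility using (_∣_; m%n≡0⇒n∣m)
open import Data.Nat.Induction using (<-wellFounded)
open import Data.Nat.ListAction using (sum)
open import Data.Nat.Properties
open import Data.Nat.Tactic.RingSolver using (solve-∀)
open import Data.Product using (Σ; ∃-syntax; _×_; _,_; proj₁; proj₂)
open import Data.Sum using (_⊎_; inj₁; inj₂)
open import Function using (id; _∘_; _⇔_; mk⇔; Equivalence)
open import Induction.WellFounded using (Acc; acc)
open import Relation.Binary using (Tri; tri<; tri≈; tri>)
open import Relation.Binary.PropositionalEquality hiding (J)
open import Relation.Nullary using (¬_; yes; no)
open import Relation.Nullary.Decidable using (⌊_⌋; _×-dec_; toWitness; fromWitness)

-- Offsets in ℤ/n

[m%n+o]%n≡[m+o]%n : ∀ m o n .{{_ : NonZero n}} → (m % n + o) % n ≡ (m + o) % n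
[m%n+o]%n≡[m+o]%n m o n = begin
  (m % n + o) % n         ≡⟨ %-distribˡ-+ (m % n) o n ⟩
  (m % n % n + o % n) % n ≡⟨ cong (λ z → (z + o % n) % n) (m%n%n≡m%n m n) ⟩
  (m % n + o % n) % n     ≡⟨ %-distribˡ-+ m o n ⟨
  (m + o) % n             ∎
  where open ≡-Reasoning

+-%-cancelˡ : ∀ {x p q n} .{{_ : NonZero n}} → x ≤ n →
              (x + p) % n ≡ (x + q) % n → p % n ≡ q % n
+-%-cancelˡ {x} {p} {q} {n} x≤n eq = begin
  p % n                         ≡⟨ shift p ⟨
  ((x + p) % n + (n ∸ x)) % n   ≡⟨ cong (λ z → (z + (n ∸ x)) % n) eq ⟩
  ((x + q) % n + (n ∸ x)) % n   ≡⟨ shift q ⟩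
  q % n                         ∎
  where
  open ≡-Reasoning
  shift : ∀ p → ((x + p) % n + (n ∸ x)) % n ≡ p % n
  shift p = begin
    ((x + p) % n + (n ∸ x)) % n ≡⟨ [m%n+o]%n≡[m+o]%n (x + p) (n ∸ x) n ⟩
    (x + p + (n ∸ x)) % n       ≡⟨ cong (_% n) (+-assoc x p (n ∸ x)) ⟩
    (x + (p + (n ∸ x))) % n     ≡⟨ cong (λ z → (x + z) % n) (+-comm p (n ∸ x)) ⟩
    (x + ((n ∸ x) + p)) % n     ≡⟨ cong (_% n) (+-assoc x (n ∸ x) p) ⟨
    (x + (n ∸ x) + p) % n       ≡⟨ cong (λ z → (z + p) % n) (m+[n∸m]≡n x≤n) ⟩
    (n + p) % n                 ≡⟨ cong (_% n) (+-comm n p) ⟩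
    (p + n) % n                 ≡⟨ [m+n]%n≡m%n p n ⟩
    p % n                       ∎

[m+o%n]%n≡[m+o]%n : ∀ m o n .{{_ : NonZero n}} → (m + o % n) % n ≡ (m + o) % n
[m+o%n]%n≡[m+o]%n m o n = begin
  (m + o % n) % n ≡⟨ cong (_% n) (+-comm m (o % n)) ⟩
  (o % n + m) % n ≡⟨ [m%n+o]%n≡[m+o]%n o m n ⟩
  (o + m) % n     ≡⟨ cong (_% n) (+-comm o m) ⟩
  (m + o) % n     ∎
  where open ≡-Reasoning

offset : (n : ℕ) .{{_ : NonZero n}} → ℕ → ℕ → ℕ
offset n x y = (y + n ∸ x) % n

module _ {n : ℕ} .{{_ : NonZero n}} where

  +-offset : ∀ {x y} → x ≤ n → y < n → (x + offset n x y) % n ≡ y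
  +-offset {x} {y} x≤n y<n = begin
    (x + offset n x y) % n ≡⟨ [m+o%n]%n≡[m+o]%n x (y + n ∸ x) n ⟩
    (x + (y + n ∸ x)) % n  ≡⟨ cong (_% n) (m+[n∸m]≡n (≤-trans x≤n (m≤n+m n y))) ⟩
    (y + n) % n            ≡⟨ [m+n]%n≡m%n y n ⟩
    y % n                  ≡⟨ m<n⇒m%n≡m y<n ⟩
    y                      ∎
    where open ≡-Reasoning

  offset-+ : ∀ {x c} → x ≤ n → c < n → offset n x ((x + c) % n) ≡ c
  offset-+ {x} {c} x≤n c<n = begin
    ((x + c) % n + n ∸ x) % n   ≡⟨ cong (_% n) (+-∸-assoc ((x + c) % n) x≤n) ⟩
    ((x + c) % n + (n ∸ x)) % n ≡⟨ [m%n+o]%n≡[m+o]%n (x + c) (n ∸ x) n ⟩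
    (x + c + (n ∸ x)) % n       ≡⟨ cong (_% n) (+-assoc x c (n ∸ x)) ⟩
    (x + (c + (n ∸ x))) % n     ≡⟨ cong (λ z → (x + z) % n) (+-∸-assoc c x≤n) ⟨
    (x + (c + n ∸ x)) % n       ≡⟨ cong (_% n) (m+[n∸m]≡n (≤-trans x≤n (m≤n+m n c))) ⟩
    (c + n) % n                 ≡⟨ [m+n]%n≡m%n c n ⟩
    c % n                       ≡⟨ m<n⇒m%n≡m c<n ⟩
    c                           ∎
    where open ≡-Reasoning

  offset-self : ∀ {x} → x ≤ n → offset n x x ≡ 0
  offset-self {x} x≤n = trans (cong (_% n) (m+n∸m≡n x n)) (n%n≡0 n)

  offset>0 : ∀ {x y} → x < n → y < n → x ≢ y → 0 < offset n x y
  offset>0 {x} {y} x<n y<n x≢y with offset n x y in eq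
  ... | suc _ = z<s
  ... | zero  = ⊥-elim (x≢y (begin
    x           ≡⟨ m<n⇒m%n≡m x<n ⟨
    x % n       ≡⟨ cong (_% n) (+-identityʳ x) ⟨
    (x + 0) % n ≡⟨ cong (λ z → (x + z) % n) eq ⟨
    (x + offset n x y) % n ≡⟨ +-offset (<⇒≤ x<n) y<n ⟩
    y           ∎))
    where open ≡-Reasoning

  private
    offset+offset-< : ∀ {x y} → x < y → y < n → offset n x y + offset n y x ≡ n
    offset+offset-< {x} {y} x<y y<n = begin
      (y + n ∸ x) % n + (x + n ∸ y) % n
        ≡⟨ cong₂ (λ p q → (p + n ∸ x) % n + (x + n ∸ q) % n) (sym x+e≡y) (sym x+e≡y) ⟩
      (x + e + n ∸ x) % n + (x + n ∸ (x + e)) % n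
        ≡⟨ cong₂ _+_ (cong (_% n) (trans (cong (_∸ x) (+-assoc x e n)) (m+n∸m≡n x (e + n))))
                     (cong (_% n) ([m+n]∸[m+o]≡n∸o x n e)) ⟩
      (e + n) % n + (n ∸ e) % n
        ≡⟨ cong₂ _+_ (trans ([m+n]%n≡m%n e n) (m<n⇒m%n≡m e<n))
                     (m<n⇒m%n≡m (∸-monoʳ-< {o = 0} (m<n⇒0<n∸m x<y) (<⇒≤ e<n))) ⟩
      e + (n ∸ e)
        ≡⟨ m+[n∸m]≡n (<⇒≤ e<n) ⟩
      n ∎
      where
      open ≡-Reasoning
      e = y ∸ x
      x+e≡y : x + e ≡ y
      x+e≡y = m+[n∸m]≡n (<⇒≤ x<y)
      e<n : e < n
      e<n = ≤-<-trans (m∸n≤m y x) y<n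

  offset+offset≡n : ∀ {x y} → x < n → y < n → x ≢ y → offset n x y + offset n y x ≡ n
  offset+offset≡n {x} {y} x<n y<n x≢y with <-cmp x y
  ... | tri< x<y _ _ = offset+offset-< x<y y<n
  ... | tri≈ _ x≡y _ = ⊥-elim (x≢y x≡y)
  ... | tri> _ _ y<x = trans (+-comm (offset n x y) (offset n y x)) (offset+offset-< y<x x<n)

-- Finite sums

∑< : ℕ → (ℕ → ℕ) → ℕ
∑< zero    f = 0
∑< (suc n) f = f 0 + ∑< n (f ∘ suc)

∑<-snoc : ∀ n f → ∑< (suc n) f ≡ ∑< n f + f n
∑<-snoc zero    f = +-comm (f 0) 0
∑<-snoc (suc n) f = trans (cong (f 0 +_) (∑<-snoc n (f ∘ suc))) (sym (+-assoc (f 0) _ _))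

∑<-cong : ∀ n {f g} → (∀ x → x < n → f x ≡ g x) → ∑< n f ≡ ∑< n g
∑<-cong zero    f≡g = refl
∑<-cong (suc n) f≡g = cong₂ _+_ (f≡g 0 z<s) (∑<-cong n (λ x x<n → f≡g (suc x) (s<s x<n)))

∑<-mono-≤ : ∀ n {f g} → (∀ x → x < n → f x ≤ g x) → ∑< n f ≤ ∑< n g
∑<-mono-≤ zero    f≤g = z≤n
∑<-mono-≤ (suc n) f≤g = +-mono-≤ (f≤g 0 z<s) (∑<-mono-≤ n (λ x x<n → f≤g (suc x) (s<s x<n)))

∑<-const : ∀ n c → ∑< n (λ _ → c) ≡ n * c
∑<-const zero    c = refl
∑<-const (suc n) c = cong (c +_) (∑<-const n c)

sum-tabulate-toℕ : ∀ n f → sum (tabulate {n = n} (f ∘ toℕ)) ≡ ∑< n f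
sum-tabulate-toℕ zero    f = refl
sum-tabulate-toℕ (suc n) f = cong (f 0 +_) (sum-tabulate-toℕ n (f ∘ suc))

∑<-rotate : ∀ n .{{_ : NonZero n}} c f → ∑< n (λ x → f ((x + c) % n)) ≡ ∑< n f
∑<-rotate n zero    f = ∑<-cong n λ x x<n →
  cong f (trans (cong (_% n) (+-identityʳ x)) (m<n⇒m%n≡m x<n))
∑<-rotate (suc n) (suc c) f = begin
  ∑< (suc n) (λ x → f ((x + suc c) % suc n))     ≡⟨ ∑<-cong (suc n) (λ x _ → cong f (shift x)) ⟩
  ∑< (suc n) (λ x → g (suc x % suc n))           ≡⟨ ∑<-snoc n _ ⟩
  ∑< n (λ x → g (suc x % suc n)) + g (suc n % suc n)
    ≡⟨ cong₂ _+_ (∑<-cong n (λ x x<n → cong g (m<n⇒m%n≡m (s<s x<n)))) (cong g (n%n≡0 (suc n))) ⟩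
  ∑< n (g ∘ suc) + g 0                           ≡⟨ +-comm _ (g 0) ⟩
  ∑< (suc n) g                                   ≡⟨ ∑<-rotate (suc n) c f ⟩
  ∑< (suc n) f                                   ∎
  where
  open ≡-Reasoning
  g : ℕ → ℕ
  g y = f ((y + c) % suc n)
  shift : ∀ x → (x + suc c) % suc n ≡ (suc x % suc n + c) % suc n
  shift x = trans (cong (_% suc n) (+-suc x c)) (sym ([m%n+o]%n≡[m+o]%n (suc x) c (suc n)))

count-interval : ∀ {n a b} (p : ℕ → Bool) → (∀ d → p d ≡ true ⇔ (a ≤ d × d ≤ b)) → b < n →
                 ∑< n (λ d → if p d then 1 else 0) ≡ suc b ∸ a
count-interval {n} {a} {b} p p⇔ b<n = begin
  ∑< n χ                     ≡⟨ cong (λ z → ∑< z χ) (m+[n∸m]≡n b<n) ⟨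
  ∑< (suc b + (n ∸ suc b)) χ ≡⟨ beyond (n ∸ suc b) ⟩
  suc b ∸ a                  ∎
  where
  open ≡-Reasoning
  χ : ℕ → ℕ
  χ d = if p d then 1 else 0
  χ-out : ∀ {d} → ¬ (a ≤ d × d ≤ b) → χ d ≡ 0
  χ-out {d} ∉ with p d in eq
  ... | true  = ⊥-elim (∉ (Equivalence.to (p⇔ d) eq))
  ... | false = refl
  χ-in : ∀ {d} → a ≤ d → d ≤ b → χ d ≡ 1
  χ-in {d} a≤d d≤b rewrite Equivalence.from (p⇔ d) (a≤d , d≤b) = refl
  upTo : ∀ N → N ≤ suc b → ∑< N χ ≡ N ∸ a
  upTo zero    _ = sym (0∸n≡0 a)
  upTo (suc N) N<b+1 with a ≤? N
  ... | yes a≤N = begin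
    ∑< (suc N) χ     ≡⟨ ∑<-snoc N χ ⟩
    ∑< N χ + χ N     ≡⟨ cong₂ _+_ (upTo N (<⇒≤ N<b+1)) (χ-in a≤N (≤-pred N<b+1)) ⟩
    N ∸ a + 1        ≡⟨ +-comm (N ∸ a) 1 ⟩
    suc (N ∸ a)      ≡⟨ +-∸-assoc 1 a≤N ⟨
    suc N ∸ a        ∎
  ... | no a≰N = begin
    ∑< (suc N) χ     ≡⟨ ∑<-snoc N χ ⟩
    ∑< N χ + χ N     ≡⟨ cong₂ _+_ (upTo N (<⇒≤ N<b+1)) (χ-out (a≰N ∘ proj₁)) ⟩
    N ∸ a + 0        ≡⟨ +-identityʳ (N ∸ a) ⟩
    N ∸ a            ≡⟨ m≤n⇒m∸n≡0 (<⇒≤ (≰⇒> a≰N)) ⟩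
    0                ≡⟨ m≤n⇒m∸n≡0 (≰⇒> a≰N) ⟨
    suc N ∸ a        ∎
  beyond : ∀ e → ∑< (suc b + e) χ ≡ suc b ∸ a
  beyond zero    = trans (cong (λ z → ∑< z χ) (+-identityʳ (suc b))) (upTo (suc b) ≤-refl)
  beyond (suc e) = begin
    ∑< (suc b + suc e) χ             ≡⟨ cong (λ z → ∑< z χ) (+-suc (suc b) e) ⟩
    ∑< (suc (suc b + e)) χ           ≡⟨ ∑<-snoc (suc b + e) χ ⟩
    ∑< (suc b + e) χ + χ (suc b + e) ≡⟨ cong₂ _+_ (beyond e) (χ-out (<⇒≱ (s≤s (m≤m+n b e)) ∘ proj₂)) ⟩
    suc b ∸ a + 0                    ≡⟨ +-identityʳ _ ⟩
    suc b ∸ a                        ∎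

module _ {n : ℕ} .{{_ : NonZero n}} where

  ∑<-offsets-divisible : ∀ L (w : ℕ → Fin n) → w L ≡ w 0 →
                         n ∣ ∑< L (λ t → offset n (toℕ (w t)) (toℕ (w (suc t))))
  ∑<-offsets-divisible L w closed = m%n≡0⇒n∣m _ n (begin
    ∑< L δ % n ≡⟨ +-%-cancelˡ (<⇒≤ (toℕ<n (w 0))) (begin
      (X 0 + ∑< L δ) % n ≡⟨ position L ⟩
      X L                ≡⟨ cong toℕ closed ⟩
      X 0                ≡⟨ position 0 ⟨
      (X 0 + 0) % n      ∎) ⟩
    0 % n      ≡⟨ m<n⇒m%n≡m (>-nonZero⁻¹ n) ⟩
    0          ∎)
    where
    open ≡-Reasoning
    X : ℕ → ℕ
    X t = toℕ (w t)
    δ : ℕ → ℕ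
    δ t = offset n (X t) (X (suc t))
    position : ∀ t → (X 0 + ∑< t δ) % n ≡ X t
    position zero    = trans (cong (_% n) (+-identityʳ (X 0))) (m<n⇒m%n≡m (toℕ<n (w 0)))
    position (suc t) = begin
      (X 0 + ∑< (suc t) δ) % n     ≡⟨ cong (λ z → (X 0 + z) % n) (∑<-snoc t δ) ⟩
      (X 0 + (∑< t δ + δ t)) % n   ≡⟨ cong (_% n) (+-assoc (X 0) (∑< t δ) (δ t)) ⟨
      (X 0 + ∑< t δ + δ t) % n     ≡⟨ [m%n+o]%n≡[m+o]%n (X 0 + ∑< t δ) (δ t) n ⟨
      ((X 0 + ∑< t δ) % n + δ t) % n ≡⟨ cong (λ z → (z + δ t) % n) (position t) ⟩
      (X t + δ t) % n              ≡⟨ +-offset (<⇒≤ (toℕ<n (w t))) (toℕ<n (w (suc t))) ⟩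
      X (suc t)                    ∎

-- Closed walks and odd cycles

halve : ∀ n → ∃[ h ] (n ≡ h + h ⊎ n ≡ suc (h + h))
halve zero = 0 , inj₁ refl
halve (suc n) with halve n
... | h , inj₁ even = h , inj₂ (cong suc even)
... | h , inj₂ odd  = suc h , inj₁ (trans (cong suc odd) (cong suc (sym (+-suc h h))))

double-cancel-≤ : ∀ {h J} → h + h ≤ J + J → h ≤ J
double-cancel-≤ {h} {J} 2h≤2J = ≮⇒≥ λ J<h → <⇒≱ (+-mono-< J<h J<h) 2h≤2J

double-cancel-< : ∀ {h J} → h + h < J + J → h < J
double-cancel-< {h} {J} 2h<2J = ≰⇒> λ J≤h → <⇒≱ 2h<2J (+-mono-≤ J≤h J≤h)

double-≤-odd : ∀ {h J} → h + h ≤ suc (J + J) → h ≤ J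
double-≤-odd {h} {J} 2h≤2J+1 = ≤-pred (double-cancel-< (subst (h + h <_) (cong suc (sym (+-suc J J))) (s≤s 2h≤2J+1)))

mirror-interval : ∀ {a b d e} → d + e ≡ a + b → a ≤ d → d ≤ b → a ≤ e × e ≤ b
mirror-interval {a} {b} {d} {e} d+e≡a+b a≤d d≤b =
  +-cancelʳ-≤ d a e (≤-trans (+-monoʳ-≤ a d≤b) (≤-reflexive (trans (sym d+e≡a+b) (+-comm d e)))) ,
  +-cancelʳ-≤ a e b (≤-trans (+-monoʳ-≤ e a≤d) (≤-reflexive (trans (+-comm e d) (trans d+e≡a+b (+-comm a b)))))

record ClosedWalk (G : Graph) (L : ℕ) : Set where
  field
    vtx    : ℕ → V G
    closed : vtx L ≡ vtx 0
    step   : ∀ t → t < L → adj G (vtx t) (vtx (suc t)) ≡ true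

module _ {G : Graph} where

  simple⇒loopless : IsSimple G → ∀ x → adj G x x ≢ true
  simple⇒loopless simple x loop with trans (sym loop) (IsSimple.irreflexive simple x)
  ... | ()

  ClosedWalk-map : ∀ {H L} → Hom G H → ClosedWalk G L → ClosedWalk H L
  ClosedWalk-map (φ , φ-adj) W = record
    { vtx    = φ ∘ vtx
    ; closed = cong φ closed
    ; step   = λ t t<L → φ-adj _ _ (step t t<L)
    }
    where open ClosedWalk W

  module _ {L : ℕ} (C : Cycle G L) where
    private
      instance
        L-nonZero : NonZero L
        L-nonZero = >-nonZero (<-≤-trans (s≤s z≤n) (Cycle.len≥3 C))
      wrap : ℕ → Fin L
      wrap t = fromℕ< (m%n<n t L)
      toℕ-wrap : ∀ {t} → t < L → toℕ (wrap t) ≡ t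
      toℕ-wrap t<L = trans (toℕ-fromℕ< _) (m<n⇒m%n≡m t<L)

    Cycle⇒ClosedWalk : ClosedWalk G L
    Cycle⇒ClosedWalk = record { vtx = Cycle.vtx C ∘ wrap ; closed = closed ; step = step }
      where
      closed : Cycle.vtx C (wrap L) ≡ Cycle.vtx C (wrap 0)
      closed = cong (Cycle.vtx C) (toℕ-injective
        (trans (toℕ-fromℕ< _) (trans (n%n≡0 L) (sym (toℕ-wrap (>-nonZero⁻¹ L))))))
      step : ∀ t → t < L → adj G (Cycle.vtx C (wrap t)) (Cycle.vtx C (wrap (suc t))) ≡ true
      step t t<L with m≤n⇒m<n∨m≡n t<L
      ... | inj₁ t+1<L = Cycle.edge C _ _ (inj₁ (trans (cong suc (toℕ-wrap t<L)) (sym (toℕ-wrap t+1<L))))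
      ... | inj₂ t+1≡L = Cycle.edge C _ _ (inj₂ (trans (cong suc (toℕ-wrap t<L)) t+1≡L ,
                                                 trans (toℕ-fromℕ< _) (trans (cong (_% L) t+1≡L) (n%n≡0 L))))

    Cycle⇒ClosedWalk-vtx : ∀ i → ClosedWalk.vtx Cycle⇒ClosedWalk (toℕ i) ≡ Cycle.vtx C i
    Cycle⇒ClosedWalk-vtx i = cong (Cycle.vtx C) (toℕ-injective (toℕ-wrap (toℕ<n i)))

  ClosedWalk-cast : ∀ {L L′} → L ≡ L′ → ClosedWalk G L → ClosedWalk G L′
  ClosedWalk-cast L≡L′ W = record
    { vtx    = W.vtx
    ; closed = subst (λ x → W.vtx x ≡ W.vtx 0) L≡L′ W.closed
    ; step   = λ t t<L′ → W.step t (subst (t <_) (sym L≡L′) t<L′)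
    }
    where module W = ClosedWalk W

  ClosedWalk⇒Cycle : ∀ {L} (W : ClosedWalk G L) → 3 ≤ L →
                     (∀ {i j : Fin L} → ClosedWalk.vtx W (toℕ i) ≡ ClosedWalk.vtx W (toℕ j) → i ≡ j) →
                     Cycle G L
  ClosedWalk⇒Cycle {L} W L≥3 injective = record
    { len≥3 = L≥3 ; vtx = W.vtx ∘ toℕ ; inj = injective ; edge = edge }
    where
    module W = ClosedWalk W
    edge : ∀ (i j : Fin L) → suc (toℕ i) ≡ toℕ j ⊎ (suc (toℕ i) ≡ L × toℕ j ≡ 0) →
           adj G (W.vtx (toℕ i)) (W.vtx (toℕ j)) ≡ true
    edge i j (inj₁ i+1≡j) =
      subst (λ x → adj G (W.vtx (toℕ i)) (W.vtx x) ≡ true) i+1≡j (W.step (toℕ i) (toℕ<n i))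
    edge i j (inj₂ (i+1≡L , j≡0)) =
      subst (λ x → adj G (W.vtx (toℕ i)) x ≡ true)
            (trans (cong W.vtx i+1≡L) (trans W.closed (cong W.vtx (sym j≡0))))
            (W.step (toℕ i) (toℕ<n i))

  segment : ∀ {L} (W : ClosedWalk G L) t d → t + d ≤ L →
            ClosedWalk.vtx W (t + d) ≡ ClosedWalk.vtx W t → ClosedWalk G d
  segment W t d t+d≤L return = record
    { vtx    = λ x → W.vtx (t + x)
    ; closed = trans return (cong W.vtx (sym (+-identityʳ t)))
    ; step   = λ x x<d → subst (λ y → adj G (W.vtx (t + x)) (W.vtx y) ≡ true) (sym (+-suc t x))
                                (W.step (t + x) (<-≤-trans (+-monoʳ-< t x<d) t+d≤L))
    }
    where module W = ClosedWalk W

  excise : ∀ {L d} (W : ClosedWalk G (L + d)) t → t < L →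
           ClosedWalk.vtx W t ≡ ClosedWalk.vtx W (t + d) → ClosedWalk G L
  excise {L} {d} W t t<L return = record { vtx = skip ; closed = closed ; step = step }
    where
    module W = ClosedWalk W
    skip : ℕ → V G
    skip x with x ≤? t
    ... | yes _ = W.vtx x
    ... | no  _ = W.vtx (x + d)
    skip-≤ : ∀ {x} → x ≤ t → skip x ≡ W.vtx x
    skip-≤ {x} x≤t with x ≤? t
    ... | yes _   = refl
    ... | no  x≰t = ⊥-elim (x≰t x≤t)
    skip-> : ∀ {x} → t < x → skip x ≡ W.vtx (x + d)
    skip-> {x} t<x with x ≤? t
    ... | yes x≤t = ⊥-elim (<⇒≱ t<x x≤t)
    ... | no  _   = refl
    closed : skip L ≡ skip 0
    closed = trans (skip-> t<L) (trans W.closed (sym (skip-≤ z≤n)))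
    step : ∀ x → x < L → adj G (skip x) (skip (suc x)) ≡ true
    step x x<L with <-cmp x t
    ... | tri< x<t _ _ = subst₂ (λ p q → adj G p q ≡ true) (sym (skip-≤ (<⇒≤ x<t))) (sym (skip-≤ x<t))
                           (W.step x (<-≤-trans x<L (m≤m+n L d)))
    ... | tri≈ _ refl _ = subst₂ (λ p q → adj G p q ≡ true) (trans (sym return) (sym (skip-≤ ≤-refl)))
                           (sym (skip-> ≤-refl)) (W.step (x + d) (+-monoˡ-< d x<L))
    ... | tri> _ _ t<x = subst₂ (λ p q → adj G p q ≡ true) (sym (skip-> t<x)) (sym (skip-> (m<n⇒m<1+n t<x)))
                           (W.step (x + d) (+-monoˡ-< d x<L))

  shortcut : ∀ {J} (W : ClosedWalk G (suc (J + J))) {t t′} → t < t′ → t′ < suc (J + J) →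
             ClosedWalk.vtx W t ≡ ClosedWalk.vtx W t′ → ∃[ J′ ] J′ < J × ClosedWalk G (suc (J′ + J′))
  shortcut {J} W {t} {t′} t<t′ t′<L repeat = byParity (halve d)
    where
    module W = ClosedWalk W
    L = suc (J + J)
    d = t′ ∸ t
    t+d≡t′ : t + d ≡ t′
    t+d≡t′ = m+[n∸m]≡n (<⇒≤ t<t′)
    d<L : d < L
    d<L = ≤-<-trans (m∸n≤m t′ t) t′<L
    byParity : ∃[ h ] (d ≡ h + h ⊎ d ≡ suc (h + h)) → ∃[ J′ ] J′ < J × ClosedWalk G (suc (J′ + J′))
    byParity (h , inj₂ d≡odd) =
      h , double-cancel-< (≤-pred (subst (_< L) d≡odd d<L)) ,
      subst (ClosedWalk G) d≡odd
        (segment W t d (≤-trans (≤-reflexive t+d≡t′) (<⇒≤ t′<L)) (trans (cong W.vtx t+d≡t′) (sym repeat)))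
    byParity (h , inj₁ d≡even) =
      J ∸ h , ∸-monoʳ-< 0<h h≤J ,
      excise (ClosedWalk-cast L≡L′+d W) t t<L′ (trans repeat (cong W.vtx (sym t+d≡t′)))
      where
      L′ = suc ((J ∸ h) + (J ∸ h))
      0<h : 0 < h
      0<h = n≢0⇒n>0 λ h≡0 → <⇒≢ (m<n⇒0<n∸m t<t′) (sym (trans d≡even (cong (λ x → x + x) h≡0)))
      h≤J : h ≤ J
      h≤J = double-cancel-≤ (≤-pred (subst (_< L) d≡even d<L))
      L≡L′+d : L ≡ L′ + d
      L≡L′+d = begin
        suc (J + J)                                   ≡⟨ cong (λ x → suc (x + x)) (m∸n+n≡m h≤J) ⟨
        suc ((J ∸ h) + h + ((J ∸ h) + h))             ≡⟨ regroup (J ∸ h) h ⟩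
        L′ + (h + h)                                  ≡⟨ cong (L′ +_) d≡even ⟨
        L′ + d                                        ∎
        where
        open ≡-Reasoning
        regroup : ∀ x h → suc (x + h + (x + h)) ≡ suc (x + x) + (h + h)
        regroup = solve-∀
      t<L′ : t < L′
      t<L′ = +-cancelʳ-< d t L′ (subst (_< L′ + d) (sym t+d≡t′) (subst (t′ <_) L≡L′+d t′<L))

  oddClosedWalk⇒oddCycle : IsSimple G → ∀ {J} → ClosedWalk G (suc (J + J)) →
                           ∃[ j ] 2 * j + 3 ≤ suc (J + J) × Cycle G (2 * j + 3)
  oddClosedWalk⇒oddCycle simple {J} = go J (<-wellFounded J)
    where
    go : ∀ J → Acc _<_ J → ClosedWalk G (suc (J + J)) → ∃[ j ] 2 * j + 3 ≤ suc (J + J) × Cycle G (2 * j + 3)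
    go J (acc smaller) W
      with any? (λ (i : Fin (suc (J + J))) → any? (λ (j : Fin (suc (J + J))) →
             (toℕ i <? toℕ j) ×-dec (ClosedWalk.vtx W (toℕ i) Fin.≟ ClosedWalk.vtx W (toℕ j))))
    ... | yes (i , j , i<j , repeat) with shortcut W i<j (toℕ<n j) repeat
    ...   | J′ , J′<J , W′ with go J′ (smaller J′<J) W′
    ...     | j , fits , C = j , ≤-trans fits (s≤s (+-mono-≤ (<⇒≤ J′<J) (<⇒≤ J′<J))) , C
    go zero _ W | no _ =
      ⊥-elim (simple⇒loopless simple (W.vtx 0) (subst (λ x → adj G (W.vtx 0) x ≡ true) W.closed (W.step 0 z<s)))
      where module W = ClosedWalk W
    go (suc J) _ W | no noRepeat =
      J , ≤-reflexive (sym L≡) ,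
      subst (Cycle G) L≡ (ClosedWalk⇒Cycle W (s≤s (s≤s (≤-trans (s≤s z≤n) (m≤n+m (suc J) J)))) injective)
      where
      L≡ : suc (suc J + suc J) ≡ 2 * J + 3
      L≡ = length J
        where
        length : ∀ J → suc (suc J + suc J) ≡ 2 * J + 3
        length = solve-∀
      injective : ∀ {i j} → ClosedWalk.vtx W (toℕ i) ≡ ClosedWalk.vtx W (toℕ j) → i ≡ j
      injective {i} {j} same with <-cmp (toℕ i) (toℕ j)
      ... | tri< i<j _ _ = ⊥-elim (noRepeat (i , j , i<j , same))
      ... | tri≈ _ i≡j _ = toℕ-injective i≡j
      ... | tri> _ _ j<i = ⊥-elim (noRepeat (j , i , j<i , sym same))

odd-below : ∀ {J k} → J < k → suc (J + J) ≤ 2 * k ∸ 1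
odd-below {J} {suc k} (s≤s J≤k) = subst (suc (J + J) ≤_) (sym (length k)) (s≤s (+-mono-≤ J≤k J≤k))
  where
  length : ∀ k → k + 1 * suc k ≡ suc (k + k)
  length = solve-∀

collapsedCycle⇒shortOddCycle : ∀ {G H k} → IsSimple H → (φ : Hom G H) → (C : Cycle G (2 * k + 1)) →
                               ∀ {i j} → i ≢ j → proj₁ φ (Cycle.vtx C i) ≡ proj₁ φ (Cycle.vtx C j) →
                               HasShortOddCycle H k
collapsedCycle⇒shortOddCycle {G} {H} {k} simple φ C {i} {j} i≢j collapse = byOrder (<-cmp (toℕ i) (toℕ j))
  where
  L≡ : 2 * k + 1 ≡ suc (k + k)
  L≡ = length k
    where
    length : ∀ k → 2 * k + 1 ≡ suc (k + k)
    length = solve-∀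
  W : ClosedWalk H (suc (k + k))
  W = ClosedWalk-cast L≡ (ClosedWalk-map φ (Cycle⇒ClosedWalk C))
  image : ∀ i → ClosedWalk.vtx W (toℕ i) ≡ proj₁ φ (Cycle.vtx C i)
  image i = cong (proj₁ φ) (Cycle⇒ClosedWalk-vtx C i)
  fromRepeat : ∀ {t t′} → t < t′ → t′ < 2 * k + 1 → ClosedWalk.vtx W t ≡ ClosedWalk.vtx W t′ →
               HasShortOddCycle H k
  fromRepeat {t′ = t′} t<t′ t′<L repeat with shortcut {J = k} W t<t′ (subst (t′ <_) L≡ t′<L) repeat
  ... | J′ , J′<k , W′ with oddClosedWalk⇒oddCycle simple {J′} W′
  ...   | j , fits , C′ = j , ≤-trans fits (odd-below J′<k) , C′
  byOrder : Tri (toℕ i < toℕ j) (toℕ i ≡ toℕ j) (toℕ j < toℕ i) → HasShortOddCycle H k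
  byOrder (tri< i<j _ _) = fromRepeat i<j (toℕ<n j) (trans (image i) (trans collapse (sym (image j))))
  byOrder (tri≈ _ i≡j _) = ⊥-elim (i≢j (toℕ-injective i≡j))
  byOrder (tri> _ _ j<i) = fromRepeat j<i (toℕ<n i) (trans (image j) (trans (sym collapse) (sym (image i))))

-- Circulant graphs

circulant : (n : ℕ) .{{_ : NonZero n}} → (ℕ → Bool) → Graph
circulant n c = mkGraph n (λ u v → c (offset n (toℕ u) (toℕ v)))

module _ {n : ℕ} .{{_ : NonZero n}} (c : ℕ → Bool) where

  circulant-isSimple : c 0 ≡ false → (∀ d e → d + e ≡ n → c d ≡ c e) → IsSimple (circulant n c)
  circulant-isSimple c0≡false c-symmetric = record { symmetric = symmetric ; irreflexive = irreflexive }
    where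
    symmetric : ∀ u v → c (offset n (toℕ u) (toℕ v)) ≡ c (offset n (toℕ v) (toℕ u))
    symmetric u v with u Fin.≟ v
    ... | yes refl = refl
    ... | no  u≢v  = c-symmetric _ _ (offset+offset≡n (toℕ<n u) (toℕ<n v) (u≢v ∘ toℕ-injective))
    irreflexive : ∀ u → c (offset n (toℕ u) (toℕ u)) ≡ false
    irreflexive u = trans (cong c (offset-self (<⇒≤ (toℕ<n u)))) c0≡false

  circulant-regular : IsRegular (circulant n c) (∑< n (λ d → if c d then 1 else 0))
  circulant-regular v = begin
    degree (circulant n c) v                            ≡⟨ cong sum (map-tabulate {n = n} id _) ⟩
    sum (tabulate {n = n} (χ ∘ offset n (toℕ v) ∘ toℕ)) ≡⟨ sum-tabulate-toℕ n _ ⟩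
    ∑< n (χ ∘ offset n (toℕ v))                         ≡⟨ ∑<-cong n (λ x _ → cong (χ ∘ (_% n)) (+-∸-assoc x v≤n)) ⟩
    ∑< n (λ x → χ ((x + (n ∸ toℕ v)) % n))              ≡⟨ ∑<-rotate n (n ∸ toℕ v) χ ⟩
    ∑< n χ                                              ∎
    where
    open ≡-Reasoning
    χ : ℕ → ℕ
    χ d = if c d then 1 else 0
    v≤n : toℕ v ≤ n
    v≤n = <⇒≤ (toℕ<n v)

-- The Andrásfai graph

-- For L = 2J+1 the range [La, Lb] lies strictly between Jn and (J+1)n, the gaps being (K-J)s+1.
oddWinding-impossible : ∀ {K J s q} → J ≤ K →
                        suc (J + J) * suc (K * s) ≤ q * andrasfaiOrder (suc K) (suc s) →
                        q * andrasfaiOrder (suc K) (suc s) ≤ suc (J + J) * suc (suc K * s) → ⊥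
oddWinding-impossible {K} {J} {s} {q} J≤K lower upper with m≤n⇒∃[o]m+o≡n J≤K | q ≤? J
... | e , refl | yes q≤J = <⇒≱ (subst (J * n <_) (sym (identity J e s)) (m<m+n (J * n) z<s))
                                (≤-trans lower (*-monoˡ-≤ n q≤J))
  where
  n = andrasfaiOrder (suc (J + e)) (suc s)
  identity : ∀ J e s → suc (J + J) * suc ((J + e) * s) ≡
                       J * (2 + ((J + e) + 1 * suc (J + e)) * s) + suc (e * s)
  identity = solve-∀
... | e , refl | no q≰J = <⇒≱ (subst (suc (J + J) * b <_) (sym (identity J e s)) (m<m+n _ z<s))
                               (≤-trans (*-monoˡ-≤ n (≰⇒> q≰J)) upper)
  where
  n = andrasfaiOrder (suc (J + e)) (suc s)
  b = suc (suc (J + e) * s)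
  identity : ∀ J e s → suc J * (2 + ((J + e) + 1 * suc (J + e)) * s) ≡
                       suc (J + J) * suc (suc (J + e) * s) + suc (e * s)
  identity = solve-∀

andrasfaiConnection : ℕ → ℕ → ℕ → Bool
andrasfaiConnection k r d =
  ⌊ (k ∸ 1) * andrasfaiOrder k r <? d * (2 * k ∸ 1) ⌋ ∧ ⌊ d * (2 * k ∸ 1) <? k * andrasfaiOrder k r ⌋

module AndrasfaiGraph (K s : ℕ) where

  k = suc K
  r = suc s
  n = andrasfaiOrder k r
  m = 2 * k ∸ 1
  a = suc (K * s)
  b = suc (k * s)

  connection : ℕ → Bool
  connection = andrasfaiConnection k r

  -- Definitionally equal to Andrasfai k r.
  G : Graph
  G = circulant n connection

  -- m = 2 * suc K ∸ 1 reduces to K + 1 * suc K, which is how m and n are written in the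
  -- ring-solver identities of this module.
  m≡1+2K : m ≡ suc (K + K)
  m≡1+2K = identity K
    where
    identity : ∀ K → K + 1 * suc K ≡ suc (K + K)
    identity = solve-∀

  a+b≡n : a + b ≡ n
  a+b≡n = identity K s
    where
    identity : ∀ K s → suc (K * s) + suc (suc K * s) ≡ 2 + (K + 1 * suc K) * s
    identity = solve-∀

  a*m≡1+K*n : a * m ≡ suc (K * n)
  a*m≡1+K*n = identity K s
    where
    identity : ∀ K s → suc (K * s) * (K + 1 * suc K) ≡ suc (K * (2 + (K + 1 * suc K) * s))
    identity = solve-∀

  1+b*m≡k*n : suc (b * m) ≡ k * n
  1+b*m≡k*n = identity K s
    where
    identity : ∀ K s → suc (suc (suc K * s) * (K + 1 * suc K)) ≡ suc K * (2 + (K + 1 * suc K) * s)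
    identity = solve-∀

  b<n : b < n
  b<n = subst (b <_) (trans (+-comm b a) a+b≡n) (m<m+n b {a} z<s)

  instance
    m-nonZero : NonZero m
    m-nonZero = >-nonZero (subst (0 <_) (sym m≡1+2K) z<s)

  connection⇔ : ∀ d → connection d ≡ true ⇔ (a ≤ d × d ≤ b)
  connection⇔ d = mk⇔
    (λ c≡true → let lower , upper = Equivalence.to (T-∧ {⌊ lowerTest ⌋}) (Equivalence.from T-≡ c≡true) in
       above (toWitness lower) , below (toWitness upper))
    (λ (a≤d , d≤b) → Equivalence.to T-≡ (Equivalence.from (T-∧ {⌊ lowerTest ⌋})
       (fromWitness {a? = lowerTest} (subst (_≤ d * m) a*m≡1+K*n (*-monoˡ-≤ m a≤d)) ,
        fromWitness {a? = upperTest} (subst (d * m <_) 1+b*m≡k*n (s≤s (*-monoˡ-≤ m d≤b))))))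
    where
    lowerTest = K * n <? d * m
    upperTest = d * m <? k * n
    above : K * n < d * m → a ≤ d
    above K*n<d*m = *-cancelʳ-≤ a d m (subst (_≤ d * m) (sym a*m≡1+K*n) K*n<d*m)
    below : d * m < k * n → d ≤ b
    below d*m<k*n = *-cancelʳ-≤ d b m (≤-pred (subst (d * m <_) (sym 1+b*m≡k*n) d*m<k*n))

  isSimple : IsSimple G
  isSimple = circulant-isSimple connection connection0≡false reflect
    where
    connection0≡false : connection 0 ≡ false
    connection0≡false = ¬-not λ c0≡true → n≮0 (proj₁ (Equivalence.to (connection⇔ 0) c0≡true))
    mirror : ∀ d e → d + e ≡ n → connection d ≡ true → connection e ≡ true
    mirror d e d+e≡n cd≡true = let a≤d , d≤b = Equivalence.to (connection⇔ d) cd≡true in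
      Equivalence.from (connection⇔ e) (mirror-interval (trans d+e≡n (sym a+b≡n)) a≤d d≤b)
    reflect : ∀ d e → d + e ≡ n → connection d ≡ connection e
    reflect d e d+e≡n = ⇔→≡ (mk⇔ (mirror d e d+e≡n) (mirror e d (trans (+-comm e d) d+e≡n)))

  regular : IsRegular G r
  regular v = begin
    degree G v                                        ≡⟨ circulant-regular connection v ⟩
    ∑< n (λ d → if connection d then 1 else 0)        ≡⟨ count-interval connection connection⇔ b<n ⟩
    suc b ∸ a                                         ≡⟨ m+n∸n≡m r (K * s) ⟩
    r                                                 ∎
    where open ≡-Reasoning

  oddCycleFree : OddCycleFree G k
  oddCycleFree (j , fits , C) = oddWinding-impossible {q = q} J≤K lower upper
    where
    J = suc j
    len = 2 * j + 3
    len≡ : len ≡ suc (J + J)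
    len≡ = identity j
      where
      identity : ∀ j → 2 * j + 3 ≡ suc (suc j + suc j)
      identity = solve-∀
    J≤K : J ≤ K
    J≤K = double-cancel-≤ (≤-pred (subst₂ _≤_ len≡ m≡1+2K fits))
    module W = ClosedWalk (Cycle⇒ClosedWalk C)
    δ : ℕ → ℕ
    δ t = offset n (toℕ (W.vtx t)) (toℕ (W.vtx (suc t)))
    δ-range : ∀ t → t < len → a ≤ δ t × δ t ≤ b
    δ-range t t<len = Equivalence.to (connection⇔ (δ t)) (W.step t t<len)
    winding : n ∣ ∑< len δ
    winding = ∑<-offsets-divisible len W.vtx W.closed
    q = _∣_.quotient winding
    lower : suc (J + J) * a ≤ q * n
    lower = begin
      suc (J + J) * a  ≡⟨ cong (_* a) len≡ ⟨
      len * a          ≡⟨ ∑<-const len a ⟨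
      ∑< len (λ _ → a) ≤⟨ ∑<-mono-≤ len (λ t t<len → proj₁ (δ-range t t<len)) ⟩
      ∑< len δ         ≡⟨ _∣_.equality winding ⟩
      q * n            ∎
      where open ≤-Reasoning
    upper : q * n ≤ suc (J + J) * b
    upper = begin
      q * n            ≡⟨ _∣_.equality winding ⟨
      ∑< len δ         ≤⟨ ∑<-mono-≤ len (λ t t<len → proj₂ (δ-range t t<len)) ⟩
      ∑< len (λ _ → b) ≡⟨ ∑<-const len b ⟩
      len * b          ≡⟨ cong (_* b) len≡ ⟩
      suc (J + J) * b  ∎
      where open ≤-Reasoning

  adjacent-step : ∀ {x y : Fin n} c → toℕ y ≡ (toℕ x + c) % n → a ≤ c → c ≤ b → adj G x y ≡ true
  adjacent-step {x} {y} c y≡x+c a≤c c≤b = begin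
    connection (offset n (toℕ x) (toℕ y))               ≡⟨ cong (connection ∘ offset n (toℕ x)) y≡x+c ⟩
    connection (offset n (toℕ x) ((toℕ x + c) % n))     ≡⟨ cong connection (offset-+ (<⇒≤ (toℕ<n x)) (≤-<-trans c≤b b<n)) ⟩
    connection c                                        ≡⟨ Equivalence.from (connection⇔ c) (a≤c , c≤b) ⟩
    true                                                ∎
    where open ≡-Reasoning

  L = 2 * k + 1

  L≡3+2K : L ≡ suc (suc (suc (K + K)))
  L≡3+2K = identity K
    where
    identity : ∀ K → 2 * suc K + 1 ≡ suc (suc (suc (K + K)))
    identity = solve-∀

  data IndexView : ℕ → Set where
    start : IndexView 0
    odd   : ∀ g h → g + h ≡ K → IndexView (suc (h + h))
    even  : ∀ g h → g + h ≡ K → IndexView (suc (suc (h + h)))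

  view : ∀ i → i < L → IndexView i
  view i i<L with halve i
  ... | zero  , inj₁ i≡0      = subst IndexView (sym i≡0) start
  ... | suc h , inj₁ i≡2h+2   = subst IndexView (sym (trans i≡2h+2 (cong suc (+-suc h h))))
                                  (even (K ∸ h) h (m∸n+n≡m (double-≤-odd {h} (≤-pred (≤-pred (<⇒≤ i<L′))))))
    where
    i<L′ : suc (suc (h + h)) < suc (suc (suc (K + K)))
    i<L′ = subst₂ _<_ (trans i≡2h+2 (cong suc (+-suc h h))) L≡3+2K i<L
  ... | h     , inj₂ i≡2h+1   = subst IndexView (sym i≡2h+1)
                                  (odd (K ∸ h) h (m∸n+n≡m (double-≤-odd {h} (≤-pred (≤-pred i<L′)))))
    where
    i<L′ : suc (h + h) < suc (suc (suc (K + K)))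
    i<L′ = subst₂ _<_ i≡2h+1 L≡3+2K i<L

  -- Leave u by a step y, take 2K+1 steps a and return by a step a + σ. Since 2a = n - s,
  -- positions 2h+1 and 2h+2 lie at u + (g s + ρ + 1) and one further step a on, where
  -- g = K - h; position 2(K-q)+1 is therefore u + (q s + ρ + 1).
  module ZigzagCycle (u : Fin n) {ρ q : ℕ} (ρ<s : ρ < s) (q≤K : q ≤ K) where

    U = toℕ u
    y = suc (K * s + ρ)
    σ = s ∸ suc ρ

    position : ℕ → ℕ
    position zero    = 0
    position (suc i) = y + i * a

    point : ℕ → Fin n
    point p = fromℕ< (m%n<n (U + p) n)

    vertex : Fin L → Fin n
    vertex i = point (position (toℕ i))

    point-adjacent : ∀ {p p′} c ℓ → p + c ≡ p′ + ℓ * n → a ≤ c → c ≤ b → adj G (point p) (point p′) ≡ true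
    point-adjacent {p} {p′} c ℓ p+c≡p′+ℓn a≤c c≤b = adjacent-step {point p} {point p′} c (begin
      toℕ (point p′)                 ≡⟨ toℕ-fromℕ< _ ⟩
      (U + p′) % n                   ≡⟨ [m+kn]%n≡m%n (U + p′) ℓ n ⟨
      (U + p′ + ℓ * n) % n           ≡⟨ cong (_% n) (+-assoc U p′ (ℓ * n)) ⟩
      (U + (p′ + ℓ * n)) % n         ≡⟨ cong (λ z → (U + z) % n) p+c≡p′+ℓn ⟨
      (U + (p + c)) % n              ≡⟨ cong (_% n) (+-assoc U p c) ⟨
      (U + p + c) % n                ≡⟨ [m%n+o]%n≡[m+o]%n (U + p) c n ⟨
      ((U + p) % n + c) % n          ≡⟨ cong (λ z → (z + c) % n) (toℕ-fromℕ< (m%n<n (U + p) n)) ⟨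
      (toℕ (point p) + c) % n        ∎) a≤c c≤b
      where open ≡-Reasoning

    first-step : position 0 + y ≡ position 1 + 0 * n
    first-step = sym (trans (+-identityʳ (y + 0)) (+-identityʳ y))

    middle-step : ∀ t → position (suc t) + a ≡ position (suc (suc t)) + 0 * n
    middle-step t = identity y a t
      where
      identity : ∀ y a t → y + t * a + a ≡ y + suc t * a + 0
      identity = solve-∀

    closing-step : position (suc (suc (K + K))) + (a + σ) ≡ position 0 + k * n
    closing-step = subst (λ s′ → suc (K * s′ + ρ) + suc (K + K) * suc (K * s′) + (suc (K * s′) + σ) ≡
                                 suc K * (2 + (K + 1 * suc K) * s′))
                         (m+[n∸m]≡n ρ<s) (identity K ρ σ)
      where
      identity : ∀ K ρ σ →
        suc (K * suc (ρ + σ) + ρ) + suc (K + K) * suc (K * suc (ρ + σ)) + (suc (K * suc (ρ + σ)) + σ) ≡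
        suc K * (2 + (K + 1 * suc K) * suc (ρ + σ))
      identity = solve-∀

    residue : ∀ {i} → IndexView i → ℕ
    residue start        = 0
    residue (odd g _ _)  = suc (g * s + ρ)
    residue (even g _ _) = suc (g * s + ρ) + a

    laps : ∀ {i} → IndexView i → ℕ
    laps start        = 0
    laps (odd _ h _)  = h
    laps (even _ h _) = h

    position-view : ∀ {i} (v : IndexView i) → position i ≡ residue v + laps v * n
    position-view start = refl
    position-view (odd g h g+h≡K) =
      subst (λ K → suc (K * s + ρ) + (h + h) * suc (K * s) ≡ suc (g * s + ρ) + h * (2 + (K + 1 * suc K) * s))
            g+h≡K (identity g h s ρ)
      where
      identity : ∀ g h s ρ → suc ((g + h) * s + ρ) + (h + h) * suc ((g + h) * s) ≡
                             suc (g * s + ρ) + h * (2 + ((g + h) + 1 * suc (g + h)) * s)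
      identity = solve-∀
    position-view (even g h g+h≡K) =
      subst (λ K → suc (K * s + ρ) + suc (h + h) * suc (K * s) ≡
                   suc (g * s + ρ) + suc (K * s) + h * (2 + (K + 1 * suc K) * s))
            g+h≡K (identity g h s ρ)
      where
      identity : ∀ g h s ρ → suc ((g + h) * s + ρ) + suc (h + h) * suc ((g + h) * s) ≡
                             suc (g * s + ρ) + suc ((g + h) * s) + h * (2 + ((g + h) + 1 * suc (g + h)) * s)
      identity = solve-∀

    part≤K : ∀ g {h} → g + h ≡ K → g ≤ K
    part≤K g g+h≡K = m+n≤o⇒m≤o g (≤-reflexive g+h≡K)

    odd-residue<b : ∀ g → g ≤ K → suc (g * s + ρ) < b
    odd-residue<b g g≤K = s≤s (subst (g * s + ρ <_) (+-comm (K * s) s) (+-mono-≤-< (*-monoˡ-≤ s g≤K) ρ<s))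

    residue<n : ∀ {i} (v : IndexView i) → residue v < n
    residue<n start             = z<s
    residue<n (odd g h g+h≡K)  = <-trans (odd-residue<b g (part≤K g g+h≡K)) b<n
    residue<n (even g h g+h≡K) =
      subst (suc (g * s + ρ) + a <_) (trans (+-comm b a) a+b≡n) (+-monoˡ-< a (odd-residue<b g (part≤K g g+h≡K)))

    position-mod : ∀ {i} (v : IndexView i) → position i % n ≡ residue v
    position-mod v = trans (cong (_% n) (position-view v))
                           (trans ([m+kn]%n≡m%n (residue v) (laps v) n) (m<n⇒m%n≡m (residue<n v)))

    same-half : ∀ g h g′ h′ → g + h ≡ K → g′ + h′ ≡ K → g * s + ρ ≡ g′ * s + ρ → h ≡ h′
    same-half g h g′ h′ g+h≡K g′+h′≡K same =
      +-cancelˡ-≡ g h h′ (trans g+h≡K (trans (sym g′+h′≡K) (cong (_+ h′) (sym g≡g′))))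
      where
      instance
        s-nonZero : NonZero s
        s-nonZero = >-nonZero (≤-<-trans z≤n ρ<s)
      g≡g′ : g ≡ g′
      g≡g′ = *-cancelʳ-≡ g g′ s (+-cancelʳ-≡ ρ (g * s) (g′ * s) same)

    odd-residue<even-residue : ∀ g g′ → g ≤ K → suc (g * s + ρ) < suc (g′ * s + ρ) + a
    odd-residue<even-residue g g′ g≤K = begin-strict
      suc (g * s + ρ)      ≤⟨ s≤s (+-monoˡ-≤ ρ (*-monoˡ-≤ s g≤K)) ⟩
      a + ρ                <⟨ +-monoʳ-< a (s≤s (m≤n+m ρ (g′ * s))) ⟩
      a + suc (g′ * s + ρ) ≡⟨ +-comm a _ ⟩
      suc (g′ * s + ρ) + a ∎
      where open ≤-Reasoning

    residue-injective : ∀ {i j} (v : IndexView i) (w : IndexView j) → residue v ≡ residue w → i ≡ j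
    residue-injective start start _ = refl
    residue-injective (odd g h g+h≡K) (odd g′ h′ g′+h′≡K) same =
      cong (λ h → suc (h + h)) (same-half g h g′ h′ g+h≡K g′+h′≡K (suc-injective same))
    residue-injective (even g h g+h≡K) (even g′ h′ g′+h′≡K) same =
      cong (λ h → suc (suc (h + h))) (same-half g h g′ h′ g+h≡K g′+h′≡K (suc-injective (+-cancelʳ-≡ a _ _ same)))
    residue-injective (odd g h g+h≡K) (even g′ h′ _) same =
      ⊥-elim (<-irrefl same (odd-residue<even-residue g g′ (part≤K g g+h≡K)))
    residue-injective (even g h _) (odd g′ h′ g′+h′≡K) same =
      ⊥-elim (<-irrefl (sym same) (odd-residue<even-residue g′ g (part≤K g′ g′+h′≡K)))

    consecutive : ∀ t → adj G (point (position t)) (point (position (suc t))) ≡ true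
    consecutive zero    = point-adjacent y 0 first-step (s≤s (m≤m+n (K * s) ρ))
                            (s≤s (subst (K * s + ρ ≤_) (+-comm (K * s) s) (+-monoʳ-≤ (K * s) (<⇒≤ ρ<s))))
    consecutive (suc t) = point-adjacent a 0 (middle-step t) ≤-refl (s≤s (m≤n+m (K * s) s))

    closing : adj G (point (position (suc (suc (K + K))))) (point (position 0)) ≡ true
    closing = point-adjacent (a + σ) k closing-step (m≤m+n a σ)
                (s≤s (subst (K * s + σ ≤_) (+-comm (K * s) s) (+-monoʳ-≤ (K * s) (m∸n≤m s (suc ρ)))))

    vertex-injective : ∀ {i j : Fin L} → vertex i ≡ vertex j → i ≡ j
    vertex-injective {i} {j} same = toℕ-injective (residue-injective vi vj (begin
      residue vi               ≡⟨ position-mod vi ⟨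
      position (toℕ i) % n     ≡⟨ +-%-cancelˡ (<⇒≤ (toℕ<n u)) (begin
        (U + position (toℕ i)) % n ≡⟨ toℕ-fromℕ< _ ⟨
        toℕ (vertex i)             ≡⟨ cong toℕ same ⟩
        toℕ (vertex j)             ≡⟨ toℕ-fromℕ< _ ⟩
        (U + position (toℕ j)) % n ∎) ⟩
      position (toℕ j) % n     ≡⟨ position-mod vj ⟩
      residue vj               ∎))
      where
      open ≡-Reasoning
      vi = view (toℕ i) (toℕ<n i)
      vj = view (toℕ j) (toℕ<n j)

    cycle : Cycle G L
    cycle = record
      { len≥3 = subst (3 ≤_) (sym L≡3+2K) (s≤s (s≤s (s≤s z≤n)))
      ; vtx   = vertex
      ; inj   = vertex-injective
      ; edge  = edge
      }
      where
      edge : ∀ (i j : Fin L) → suc (toℕ i) ≡ toℕ j ⊎ (suc (toℕ i) ≡ L × toℕ j ≡ 0) →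
             adj G (vertex i) (vertex j) ≡ true
      edge i j (inj₁ i+1≡j) =
        subst (λ t → adj G (vertex i) (point (position t)) ≡ true) i+1≡j (consecutive (toℕ i))
      edge i j (inj₂ (i+1≡L , j≡0)) =
        subst₂ (λ t t′ → adj G (point (position t)) (point (position t′)) ≡ true)
               (sym (suc-injective (trans i+1≡L L≡3+2K))) (sym j≡0) closing

    cycle-start : Cycle.vtx cycle Fin.zero ≡ u
    cycle-start = toℕ-injective (trans (toℕ-fromℕ< _) (trans (cong (_% n) (+-identityʳ U)) (m<n⇒m%n≡m (toℕ<n u))))

    cycle-reaches : Σ (Fin L) λ i → toℕ (Cycle.vtx cycle i) ≡ (U + suc (q * s + ρ)) % n
    cycle-reaches = fromℕ< i<L , (begin
      toℕ (vertex (fromℕ< i<L))            ≡⟨ toℕ-fromℕ< _ ⟩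
      (U + position (toℕ (fromℕ< i<L))) % n ≡⟨ cong (λ t → (U + position t) % n) (toℕ-fromℕ< i<L) ⟩
      (U + position i) % n                 ≡⟨ cong (λ p → (U + p) % n) (position-view v) ⟩
      (U + (suc (q * s + ρ) + h * n)) % n  ≡⟨ cong (_% n) (+-assoc U _ (h * n)) ⟨
      (U + suc (q * s + ρ) + h * n) % n    ≡⟨ [m+kn]%n≡m%n (U + suc (q * s + ρ)) h n ⟩
      (U + suc (q * s + ρ)) % n            ∎)
      where
      open ≡-Reasoning
      h = K ∸ q
      i = suc (h + h)
      v : IndexView i
      v = odd q h (m+[n∸m]≡n q≤K)
      i<L : i < L
      i<L = subst (i <_) (sym L≡3+2K) (s≤s (s≤s (≤-trans (+-mono-≤ (m∸n≤m K q) (m∸n≤m K q)) (n≤1+n _))))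

  CycleThrough : Fin n → Fin n → Set
  CycleThrough u v = Σ (Cycle G L) λ C → (Σ (Fin L) λ i → Cycle.vtx C i ≡ u) × (Σ (Fin L) λ j → Cycle.vtx C j ≡ v)

  cycleThrough-near : ∀ u v → 0 < s → 0 < offset n (toℕ u) (toℕ v) → offset n (toℕ u) (toℕ v) ≤ k * s →
                      CycleThrough u v
  cycleThrough-near u v 0<s 0<d d≤ks = cycle , (Fin.zero , cycle-start) , (proj₁ cycle-reaches , reaches-v)
    where
    instance
      s-nonZero : NonZero s
      s-nonZero = >-nonZero 0<s
    d = offset n (toℕ u) (toℕ v)
    ρ = (d ∸ 1) % s
    q = (d ∸ 1) / s
    d-1≡ρ+qs : d ∸ 1 ≡ ρ + q * s
    d-1≡ρ+qs = m≡m%n+[m/n]*n (d ∸ 1) s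
    q≤K : q ≤ K
    q≤K = ≤-pred (*-cancelʳ-< s q k (begin-strict
      q * s     ≤⟨ m≤n+m (q * s) ρ ⟩
      ρ + q * s ≡⟨ d-1≡ρ+qs ⟨
      d ∸ 1     <⟨ ∸-monoʳ-< {o = 0} z<s 0<d ⟩
      d         ≤⟨ d≤ks ⟩
      k * s     ∎))
      where open ≤-Reasoning
    open ZigzagCycle u (m%n<n (d ∸ 1) s) q≤K
    reaches-v : Cycle.vtx cycle (proj₁ cycle-reaches) ≡ v
    reaches-v = toℕ-injective (begin
      toℕ (Cycle.vtx cycle (proj₁ cycle-reaches)) ≡⟨ proj₂ cycle-reaches ⟩
      (toℕ u + suc (q * s + ρ)) % n
        ≡⟨ cong (λ z → (toℕ u + suc z) % n) (trans (+-comm (q * s) ρ) (sym d-1≡ρ+qs)) ⟩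
      (toℕ u + suc (d ∸ 1)) % n
        ≡⟨ cong (λ z → (toℕ u + z) % n) (trans (+-comm 1 (d ∸ 1)) (m∸n+n≡m 0<d)) ⟩
      (toℕ u + d) % n                             ≡⟨ +-offset (<⇒≤ (toℕ<n u)) (toℕ<n v) ⟩
      toℕ v                                       ∎)
      where open ≡-Reasoning

  offset-back-near : 0 < s → ∀ u v → u ≢ v → k * s < offset n (toℕ u) (toℕ v) →
                     offset n (toℕ v) (toℕ u) ≤ k * s
  offset-back-near 0<s u v u≢v far = ≤-trans (+-cancelˡ-≤ b _ a (begin
    b + offset n (toℕ v) (toℕ u)                        ≤⟨ +-monoˡ-≤ _ far ⟩
    offset n (toℕ u) (toℕ v) + offset n (toℕ v) (toℕ u) ≡⟨ offset+offset≡n (toℕ<n u) (toℕ<n v) u≢v′ ⟩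
    n                                                   ≡⟨ trans (sym a+b≡n) (+-comm a b) ⟩
    b + a                                               ∎))
    (+-monoˡ-≤ (K * s) 0<s)
    where
    open ≤-Reasoning
    u≢v′ : toℕ u ≢ toℕ v
    u≢v′ = u≢v ∘ toℕ-injective

  cycleThrough : 0 < s → ∀ u v → u ≢ v → CycleThrough u v
  cycleThrough 0<s u v u≢v with offset n (toℕ u) (toℕ v) ≤? k * s
  ... | yes near = cycleThrough-near u v 0<s (offset>0 (toℕ<n u) (toℕ<n v) (u≢v ∘ toℕ-injective)) near
  ... | no  far  =
    let C , through-v , through-u = cycleThrough-near v u 0<s
                                      (offset>0 (toℕ<n v) (toℕ<n u) (u≢v ∘ sym ∘ toℕ-injective))
                                      (offset-back-near 0<s u v u≢v (≰⇒> far))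
    in C , through-u , through-v

  adjacent-distinct : s ≡ 0 → ∀ u v → u ≢ v → adj G u v ≡ true
  adjacent-distinct s≡0 u v u≢v = Equivalence.from (connection⇔ d) (subst (_≤ d) (sym a≡1) 0<d , d≤b)
    where
    d = offset n (toℕ u) (toℕ v)
    0<d : 0 < d
    0<d = offset>0 (toℕ<n u) (toℕ<n v) (u≢v ∘ toℕ-injective)
    a≡1 : a ≡ 1
    a≡1 = cong suc (trans (cong (K *_) s≡0) (*-zeroʳ K))
    d≤b : d ≤ b
    d≤b = ≤-pred (subst (d <_) (trans (sym a+b≡n) (cong (_+ b) a≡1)) (m%n<n (toℕ v + n ∸ toℕ u) n))

  hom-to-smaller⇒shortOddCycle : ∀ H → IsSimple H → Hom G H → order H < n → HasShortOddCycle H k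
  hom-to-smaller⇒shortOddCycle H simple φ |H|<n with pigeonhole |H|<n (proj₁ φ)
  ... | u , v , u<v , collapse with s ≟ 0
  ...   | yes s≡0 = ⊥-elim (simple⇒loopless simple (proj₁ φ v)
                     (subst (λ x → adj H x (proj₁ φ v) ≡ true) collapse
                            (proj₂ φ u v (adjacent-distinct s≡0 u v (<⇒≢ u<v ∘ cong toℕ)))))
  ...   | no  s≢0 with cycleThrough (n≢0⇒n>0 s≢0) u v (<⇒≢ u<v ∘ cong toℕ)
  ...     | C , (i , Ci≡u) , (j , Cj≡v) =
    collapsedCycle⇒shortOddCycle {k = k} simple φ C
      (λ i≡j → <⇒≢ u<v (cong toℕ (trans (sym Ci≡u) (trans (cong (Cycle.vtx C) i≡j) Cj≡v))))
      (trans (cong (proj₁ φ) Ci≡u) (trans collapse (cong (proj₁ φ) (sym Cj≡v))))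

deltaHom≥1/[2k-1] : ∀ K → 1 ≤ K → DeltaHomAtLeastInv (suc K)
deltaHom≥1/[2k-1] K 1≤K p q _ pm<q (H , simple , free , universal) =
  free (A.hom-to-smaller⇒shortOddCycle H simple φ |H|<n)
  where
  s = order H
  module A = AndrasfaiGraph K s
  2≤m : 2 ≤ A.m
  2≤m = subst (2 ≤_) (sym A.m≡1+2K) (s≤s (≤-trans 1≤K (m≤m+n K K)))
  minDegree : MinDegAtLeast A.G p q
  minDegree v = begin
    p * A.n                 ≡⟨ expand p A.m s ⟩
    p * 2 + p * A.m * s     ≤⟨ +-monoˡ-≤ (p * A.m * s) (*-monoʳ-≤ p 2≤m) ⟩
    p * A.m + p * A.m * s   ≡⟨ factor (p * A.m) s ⟩
    p * A.m * A.r           ≤⟨ *-monoˡ-≤ A.r (<⇒≤ pm<q) ⟩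
    q * A.r                 ≡⟨ cong (q *_) (A.regular v) ⟨
    q * degree A.G v        ∎
    where
    open ≤-Reasoning
    expand : ∀ p m s → p * (2 + m * s) ≡ p * 2 + p * m * s
    expand = solve-∀
    factor : ∀ x s → x + x * s ≡ x * suc s
    factor = solve-∀
  φ : Hom A.G H
  φ = universal A.G A.isSimple A.oddCycleFree minDegree
  |H|<n : s < A.n
  |H|<n = s≤s (≤-trans (m≤n*m s A.m) (n≤1+n _))

proposition2p2 : (k r : ℕ) → 2 ≤ k → 1 ≤ r →
    IsRegular (Andrasfai k r) r
    × OddCycleFree (Andrasfai k r) k
    × (2 ≤ r → ∀ (u v : V (Andrasfai k r)) → ¬ (u ≡ v) →
        Σ (Cycle (Andrasfai k r) (2 * k + 1)) λ C →
          (Σ (Fin (2 * k + 1)) λ i → Cycle.vtx C i ≡ u)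
          × (Σ (Fin (2 * k + 1)) λ j → Cycle.vtx C j ≡ v))
    × (∀ (H : Graph) → IsSimple H → Hom (Andrasfai k r) H →
        order H < order (Andrasfai k r) → HasShortOddCycle H k)
    × DeltaHomAtLeastInv k
proposition2p2 (suc K) (suc s) (s≤s 1≤K) _ =
  regular , oddCycleFree , (λ { (s≤s 1≤s) → cycleThrough 1≤s }) , hom-to-smaller⇒shortOddCycle ,
  deltaHom≥1/[2k-1] K 1≤K
  where open AndrasfaiGraph K s
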